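{- For all PTS terms $t,u$: $t\leftrightarrow_\beta^*u$ if and only if $\mathcal A(t)\leftrightarrow^*\mathcal A(u)$. For all ground PTSC terms $M,N$: $M\leftrightarrow^*N$ if and only if $\mathcal B(M)\leftrightarrow_\beta^*\mathcal B(N)$.
   Context: Ground PTSC syntax: given sorts $\mathcal S$ and variables, terms $M ::= \Pi x^{A}.B \mid \lambda x^{A}.M \mid s \mid x\,l \mid M\,l \mid \langle N/x\rangle_A M$ and lists $l ::= [\,] \mid M\cdot l \mid l @ l' \mid \langle N/x\rangle_A l$ ($\langle N/x\rangle_A$ explicit substitution binding $x$; $\Pi,\lambda$ bind $x$; up to $\alpha$-conversion). Reduction $\to$ is the contextual closure of: $(\lambda x^A.M)(N\cdot l)\to(\langle N/x\rangle_A M)\,l$; $M\,[\,]\to M$; $(x\,l)\,l'\to x\,(l@l')$; $(M\,l)\,l'\to M\,(l@l')$; $(M\cdot l')@l\to M\cdot(l'@l)$; $[\,]@l\to l$; $(l@l')@l''\to l@(l'@l'')$; $l@[\,]\to l$; $\langle P/y\rangle_G(\lambda x^A.M)\to\lambda x^{\langle P/y\rangle_G A}.\langle P/y\rangle_G M$; $\langle P/y\rangle_G(y\,l)\to P\,(\langle P/y\rangle_G l)$; $\langle P/y\rangle_G(x\,l)\to x\,(\langle P/y\rangle_G l)$ ($x\ne y$); $\langle P/y\rangle_G(M\,l)\to(\langle P/y\rangle_G M)(\langle P/y\rangle_G l)$; $\langle P/y\rangle_G(\Pi x^A.B)\to\Pi x^{\langle P/y\rangle_G A}.\langle P/y\rangle_G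 B$; $\langle P/y\rangle_G s\to s$; $\langle P/y\rangle_G[\,]\to[\,]$; $\langle P/y\rangle_G(M\cdot l)\to(\langle P/y\rangle_G M)\cdot(\langle P/y\rangle_G l)$; $\langle P/y\rangle_G(l@l')\to(\langle P/y\rangle_G l)@(\langle P/y\rangle_G l')$. $\leftrightarrow^*$ is the induced equivalence. PTS terms $t,u,T ::= x\mid s\mid\Pi x^T.t\mid\lambda x^T.t\mid t\,u$; $\to_\beta$ is the contextual closure of $(\lambda x^v.t)\,u\to t\{x:=u\}$ (capture-avoiding substitution), $\leftrightarrow_\beta^*$ its equivalence closure. Translation $\mathcal B$ (PTSC to PTS): $\mathcal B(\Pi x^A.B)=\Pi x^{\mathcal B(A)}.\mathcal B(B)$, $\mathcal B(\lambda x^A.M)=\lambda x^{\mathcal B(A)}.\mathcal B(M)$, $\mathcal B(s)=s$, $\mathcal B(x\,l)=\mathcal B^z(l)\{z:=x\}$, $\mathcal B(M\,l)=\mathcal B^z(l)\{z:=\mathcal B(M)\}$ ($z$ fresh), $\mathcal B(\langle P/x\rangle_K M)=\mathcal B(M)\{x:=\mathcal B(P)\}$; $\mathcal B^y([\,])=y$, $\mathcal B^y(M\cdot l)=\mathcal B^z(l)\{z:=y\,\mathcal B(M)\}$, $\mathcal B^y(l@l')=\mathcal B^z(l')\{z:=\mathcal B^y(l)\}$ ($z$ fresh), $\mathcal B^y(\langle P/x\rangle_K l)=\mathcal B^y(l)\{x:=\mathcal B(P)\}$. Translation $\mathcal A$ (PTS to PTSC): $\mathcal A(s)=s$, $\mathcal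 A(\Pi x^T.U)=\Pi x^{\mathcal A(T)}.\mathcal A(U)$, $\mathcal A(\lambda x^T.t)=\lambda x^{\mathcal A(T)}.\mathcal A(t)$, $\mathcal A(t)=\mathcal A_{[\,]}(t)$ if $t$ is a variable or application; $\mathcal A_l(t\,u)=\mathcal A_{\mathcal A(u)\cdot l}(t)$, $\mathcal A_l(x)=x\,l$, $\mathcal A_l(t)=\mathcal A(t)\,l$ otherwise. -}

module Defs where

-- Binders are represented by (unscoped) de Bruijn indices, which realises
-- syntax "up to alpha-conversion".  Index 0 is the innermost bound variable.

open import Data.Nat using (ℕ; zero; suc)
open import Relation.Binary.Construct.Closure.Equivalence using (EqClosure)

data Tm (S : Set) : Set where
  var  : ℕ → Tm S
  sort : S → Tm S
  pi   : Tm S → Tm S → Tm S      -- Π x^T. U   (U under binder)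
  lam  : Tm S → Tm S → Tm S      -- λ x^T. t   (t under binder)
  app  : Tm S → Tm S → Tm S

ext : (ℕ → ℕ) → ℕ → ℕ
ext ρ zero    = zero
ext ρ (suc n) = suc (ρ n)

ren : {S : Set} → (ℕ → ℕ) → Tm S → Tm S
ren ρ (var x)   = var (ρ x)
ren ρ (sort s)  = sort s
ren ρ (pi T U)  = pi (ren ρ T) (ren (ext ρ) U)
ren ρ (lam T t) = lam (ren ρ T) (ren (ext ρ) t)
ren ρ (app t u) = app (ren ρ t) (ren ρ u)

exts : {S : Set} → (ℕ → Tm S) → ℕ → Tm S
exts σ zero    = var zero
exts σ (suc n) = ren suc (σ n)

sub : {S : Set} → (ℕ → Tm S) → Tm S → Tm S
sub σ (var x)   = σ x
sub σ (sort s)  = sort s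
sub σ (pi T U)  = pi (sub σ T) (sub (exts σ) U)
sub σ (lam T t) = lam (sub σ T) (sub (exts σ) t)
sub σ (app t u) = app (sub σ t) (sub σ u)

_•_ : {S : Set} → Tm S → (ℕ → Tm S) → ℕ → Tm S
(u • σ) zero    = u
(u • σ) (suc n) = σ n

_[_] : {S : Set} → Tm S → Tm S → Tm S
t [ u ] = sub (u • var) t

data _⟶β_ {S : Set} : Tm S → Tm S → Set where
  β     : ∀ {v t u} → app (lam v t) u ⟶β (t [ u ])
  piL   : ∀ {T T' U} → T ⟶β T' → pi T U ⟶β pi T' U
  piR   : ∀ {T U U'} → U ⟶β U' → pi T U ⟶β pi T U'
  lamL  : ∀ {T T' t} → T ⟶β T' → lam T t ⟶β lam T' t
  lamR  : ∀ {T t t'} → t ⟶β t' → lam T t ⟶β lam T t'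
  appL  : ∀ {t t' u} → t ⟶β t' → app t u ⟶β app t' u
  appR  : ∀ {t u u'} → u ⟶β u' → app t u ⟶β app t u'

_↔β_ : {S : Set} → Tm S → Tm S → Set
_↔β_ = EqClosure _⟶β_

mutual
  data PT (S : Set) : Set where
    pi     : PT S → PT S → PT S          -- Π x^A. B   (B under binder)
    lam    : PT S → PT S → PT S          -- λ x^A. M   (M under binder)
    sort   : S → PT S
    varapp : ℕ → PL S → PT S
    app    : PT S → PL S → PT S
    esub   : PT S → PT S → PT S → PT S   -- ⟨N/x⟩_A M  = esub N A M (M under binder)

  data PL (S : Set) : Set where
    nil  : PL S
    cons : PT S → PL S → PL S
    cat  : PL S → PL S → PL S
    esub : PT S → PT S → PL S → PL S     -- ⟨N/x⟩_A l  (l under binder)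

mutual
  renT : {S : Set} → (ℕ → ℕ) → PT S → PT S
  renT ρ (pi A B)     = pi (renT ρ A) (renT (ext ρ) B)
  renT ρ (lam A M)    = lam (renT ρ A) (renT (ext ρ) M)
  renT ρ (sort s)     = sort s
  renT ρ (varapp x l) = varapp (ρ x) (renL ρ l)
  renT ρ (app M l)    = app (renT ρ M) (renL ρ l)
  renT ρ (esub N A M) = esub (renT ρ N) (renT ρ A) (renT (ext ρ) M)

  renL : {S : Set} → (ℕ → ℕ) → PL S → PL S
  renL ρ nil          = nil
  renL ρ (cons M l)   = cons (renT ρ M) (renL ρ l)
  renL ρ (cat l l')   = cat (renL ρ l) (renL ρ l')
  renL ρ (esub N A l) = esub (renT ρ N) (renT ρ A) (renL (ext ρ) l)

-- exchange of the two innermost variables (needed when an explicit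
-- substitution is pushed under a binder)
swap01 : ℕ → ℕ
swap01 zero          = suc zero
swap01 (suc zero)    = zero
swap01 (suc (suc n)) = suc (suc n)

mutual
  data _⟶_ {S : Set} : PT S → PT S → Set where
    B1   : ∀ {A M N l} → app (lam A M) (cons N l) ⟶ app (esub N A M) l
    B2   : ∀ {M} → app M nil ⟶ M
    B3   : ∀ {x l l'} → app (varapp x l) l' ⟶ varapp x (cat l l')
    B4   : ∀ {M l l'} → app (app M l) l' ⟶ app M (cat l l')
    C1   : ∀ {P G A M} → esub P G (lam A M) ⟶
             lam (esub P G A) (esub (renT suc P) (renT suc G) (renT swap01 M))
    C2   : ∀ {P G l} → esub P G (varapp zero l) ⟶ app P (esub P G l)
    C3   : ∀ {P G x l} → esub P G (varapp (suc x) l) ⟶ varapp x (esub P G l)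
    C4   : ∀ {P G M l} → esub P G (app M l) ⟶ app (esub P G M) (esub P G l)
    C5   : ∀ {P G A B} → esub P G (pi A B) ⟶
             pi (esub P G A) (esub (renT suc P) (renT suc G) (renT swap01 B))
    C6   : ∀ {P G s} → esub P G (sort s) ⟶ sort s
    piL    : ∀ {A A' B} → A ⟶ A' → pi A B ⟶ pi A' B
    piR    : ∀ {A B B'} → B ⟶ B' → pi A B ⟶ pi A B'
    lamL   : ∀ {A A' M} → A ⟶ A' → lam A M ⟶ lam A' M
    lamR   : ∀ {A M M'} → M ⟶ M' → lam A M ⟶ lam A M'
    varappC : ∀ {x l l'} → l ⟶ₗ l' → varapp x l ⟶ varapp x l'
    appL   : ∀ {M M' l} → M ⟶ M' → app M l ⟶ app M' l
    appR   : ∀ {M l l'} → l ⟶ₗ l' → app M l ⟶ app M l'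
    esub1  : ∀ {N N' A M} → N ⟶ N' → esub N A M ⟶ esub N' A M
    esub2  : ∀ {N A A' M} → A ⟶ A' → esub N A M ⟶ esub N A' M
    esub3  : ∀ {N A M M'} → M ⟶ M' → esub N A M ⟶ esub N A M'

  data _⟶ₗ_ {S : Set} : PL S → PL S → Set where
    A1   : ∀ {M l' l} → cat (cons M l') l ⟶ₗ cons M (cat l' l)
    A2   : ∀ {l} → cat nil l ⟶ₗ l
    A3   : ∀ {l l' l''} → cat (cat l l') l'' ⟶ₗ cat l (cat l' l'')
    A4   : ∀ {l} → cat l nil ⟶ₗ l
    D1   : ∀ {P G} → esub P G nil ⟶ₗ nil
    D2   : ∀ {P G M l} → esub P G (cons M l) ⟶ₗ cons (esub P G M) (esub P G l)
    D3   : ∀ {P G l l'} → esub P G (cat l l') ⟶ₗ cat (esub P G l) (esub P G l')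
    consL  : ∀ {M M' l} → M ⟶ M' → cons M l ⟶ₗ cons M' l
    consR  : ∀ {M l l'} → l ⟶ₗ l' → cons M l ⟶ₗ cons M l'
    catL   : ∀ {l l' k} → l ⟶ₗ l' → cat l k ⟶ₗ cat l' k
    catR   : ∀ {l k k'} → k ⟶ₗ k' → cat l k ⟶ₗ cat l k'
    esub1  : ∀ {N N' A l} → N ⟶ N' → esub N A l ⟶ₗ esub N' A l
    esub2  : ∀ {N A A' l} → A ⟶ A' → esub N A l ⟶ₗ esub N A' l
    esub3  : ∀ {N A l l'} → l ⟶ₗ l' → esub N A l ⟶ₗ esub N A l'

_↔_ : {S : Set} → PT S → PT S → Set
_↔_ = EqClosure _⟶_

-- Translation B (PTSC → PTS).
-- ℬl l is B^z(l) where the distinguished variable z is index 0 and the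
-- free variables of l are shifted up by one.

up : {S : Set} → ℕ → Tm S
up n = var (suc n)

mutual
  ℬ : {S : Set} → PT S → Tm S
  ℬ (pi A B)     = pi (ℬ A) (ℬ B)
  ℬ (lam A M)    = lam (ℬ A) (ℬ M)
  ℬ (sort s)     = sort s
  ℬ (varapp x l) = ℬl l [ var x ]
  ℬ (app M l)    = ℬl l [ ℬ M ]
  ℬ (esub P K M) = ℬ M [ ℬ P ]

  ℬl : {S : Set} → PL S → Tm S
  ℬl nil          = var zero
  -- B^y(M·l) = B^z(l){z := y B(M)}
  ℬl (cons M l)   = sub (app (var zero) (ren suc (ℬ M)) • up) (ℬl l)
  -- B^y(l@l') = B^z(l'){z := B^y(l)}
  ℬl (cat l l')   = sub (ℬl l • up) (ℬl l')
  -- B^y(⟨P/x⟩l) = B^y(l){x := B(P)}; in ℬl l, index 0 is y, index 1 is x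
  ℬl (esub P K l) = sub (var zero • (ren suc (ℬ P) • up)) (ℬl l)

mutual
  𝒜 : {S : Set} → Tm S → PT S
  𝒜 (sort s)  = sort s
  𝒜 (pi T U)  = pi (𝒜 T) (𝒜 U)
  𝒜 (lam T t) = lam (𝒜 T) (𝒜 t)
  𝒜 (var x)   = varapp x nil
  𝒜 (app t u) = 𝒜l (cons (𝒜 u) nil) t

  𝒜l : {S : Set} → PL S → Tm S → PT S
  𝒜l l (app t u) = 𝒜l (cons (𝒜 u) l) t
  𝒜l l (var x)   = varapp x l
  𝒜l l (sort s)  = app (sort s) l
  𝒜l l (pi T U)  = app (pi (𝒜 T) (𝒜 U)) l
  𝒜l l (lam T t) = app (lam (𝒜 T) (𝒜 t)) l

-- The proof rests on four facts:
--   (1) ℬ is sound:   M ⟶ N        implies  ℬ M ↔β ℬ N        (ℬ-sound);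
--   (2) 𝒜 is sound:   t ⟶β u       implies  𝒜 t ↔ 𝒜 u         (𝒜-sound);
--   (3) ℬ ∘ 𝒜 is the identity on PTS terms                    (ℬ∘𝒜);
--   (4) every PTSC term is convertible with 𝒜 (ℬ M)           (𝒜∘ℬ).
-- The corollary is then pure bookkeeping: e.g. 𝒜 t ↔ 𝒜 u gives
-- t = ℬ (𝒜 t) ↔β ℬ (𝒜 u) = u by (1) and (3).
--
-- Fact (1) reduces every PTSC rule to an
-- identity between substitutions.  Fact (2) needs the key lemma that
-- an explicit substitution of 𝒜 v into 𝒜 t converts to 𝒜 (t [ v ])
-- (𝒜-subst), proved under an arbitrary number of binders.  Fact (4)
-- follows by induction, using 𝒜-subst for explicit substitutions.

module Submission where

open import Defs
open import Data.Nat using (ℕ; zero; suc)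
open import Data.Product using (_×_; _,_; ∃)
open import Data.Sum using (_⊎_; inj₁; inj₂)
open import Function.Base using (_∘_)
open import Function.Bundles using (_⇔_; mk⇔)
open import Relation.Binary.Construct.Closure.Equivalence as EC using (EqClosure; gfold; return)
open import Relation.Binary.Construct.Closure.ReflexiveTransitive using (ε; _◅◅_)
open import Relation.Binary.PropositionalEquality hiding ([_])

≡⇒≈ : {A : Set} {R : A → A → Set} {a b : A} → a ≡ b → EqClosure R a b
≡⇒≈ refl = ε

≈-sym : {A : Set} {R : A → A → Set} {a b : A} → EqClosure R a b → EqClosure R b a
≈-sym = EC.symmetric _

≈-cong₂ : {A : Set} {R : A → A → Set} (f : A → A → A)
        → (∀ {a a' b} → R a a' → R (f a b) (f a' b))
        → (∀ {a b b'} → R b b' → R (f a b) (f a b'))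
        → ∀ {a a' b b'} → EqClosure R a a' → EqClosure R b b'
        → EqClosure R (f a b) (f a' b')
≈-cong₂ f monoˡ monoʳ {a' = a'} {b = b} p q =
  EC.gmap (λ z → f z b) monoˡ p ◅◅ EC.gmap (f a') monoʳ q

cong₃ : {A B C D : Set} (f : A → B → C → D) {a a' : A} {b b' : B} {c c' : C}
      → a ≡ a' → b ≡ b' → c ≡ c' → f a b c ≡ f a' b' c'
cong₃ f refl refl refl = refl

ext-cong : {ρ ρ' : ℕ → ℕ} → (∀ x → ρ x ≡ ρ' x) → ∀ x → ext ρ x ≡ ext ρ' x
ext-cong h zero    = refl
ext-cong h (suc x) = cong suc (h x)

ext-∘ : (ρ ρ' : ℕ → ℕ) → ∀ x → ext ρ (ext ρ' x) ≡ ext (ρ ∘ ρ') x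
ext-∘ ρ ρ' zero    = refl
ext-∘ ρ ρ' (suc x) = refl

ext-id : ∀ x → ext (λ y → y) x ≡ x
ext-id zero    = refl
ext-id (suc x) = refl

Ren : Set
Ren = ℕ → ℕ

Sub : Set → Set
Sub S = ℕ → Tm S

module PTSSubstitution {S : Set} where

  ren-cong : {ρ ρ' : Ren} → (∀ x → ρ x ≡ ρ' x) → (t : Tm S) → ren ρ t ≡ ren ρ' t
  ren-cong h (var x)   = cong var (h x)
  ren-cong h (sort s)  = refl
  ren-cong h (pi T U)  = cong₂ pi (ren-cong h T) (ren-cong (ext-cong h) U)
  ren-cong h (lam T U) = cong₂ lam (ren-cong h T) (ren-cong (ext-cong h) U)
  ren-cong h (app t u) = cong₂ app (ren-cong h t) (ren-cong h u)

  ren-ren : (ρ ρ' : Ren) (t : Tm S) → ren ρ (ren ρ' t) ≡ ren (ρ ∘ ρ') t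
  ren-ren ρ ρ' (var x)   = refl
  ren-ren ρ ρ' (sort s)  = refl
  ren-ren ρ ρ' (pi T U)  = cong₂ pi (ren-ren ρ ρ' T)
    (trans (ren-ren (ext ρ) (ext ρ') U) (ren-cong (ext-∘ ρ ρ') U))
  ren-ren ρ ρ' (lam T U) = cong₂ lam (ren-ren ρ ρ' T)
    (trans (ren-ren (ext ρ) (ext ρ') U) (ren-cong (ext-∘ ρ ρ') U))
  ren-ren ρ ρ' (app t u) = cong₂ app (ren-ren ρ ρ' t) (ren-ren ρ ρ' u)

  ren-id : (t : Tm S) → ren (λ x → x) t ≡ t
  ren-id (var x)   = refl
  ren-id (sort s)  = refl
  ren-id (pi T U)  = cong₂ pi (ren-id T) (trans (ren-cong ext-id U) (ren-id U))
  ren-id (lam T U) = cong₂ lam (ren-id T) (trans (ren-cong ext-id U) (ren-id U))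
  ren-id (app t u) = cong₂ app (ren-id t) (ren-id u)

  ren-suc-comm : (ρ : Ren) (t : Tm S) → ren suc (ren ρ t) ≡ ren (ext ρ) (ren suc t)
  ren-suc-comm ρ t = trans (ren-ren suc ρ t) (sym (ren-ren (ext ρ) suc t))

  exts-cong : {σ σ' : Sub S} → (∀ x → σ x ≡ σ' x) → ∀ x → exts σ x ≡ exts σ' x
  exts-cong h zero    = refl
  exts-cong h (suc x) = cong (ren suc) (h x)

  sub-cong : {σ σ' : Sub S} → (∀ x → σ x ≡ σ' x) → (t : Tm S) → sub σ t ≡ sub σ' t
  sub-cong h (var x)   = h x
  sub-cong h (sort s)  = refl
  sub-cong h (pi T U)  = cong₂ pi (sub-cong h T) (sub-cong (exts-cong h) U)
  sub-cong h (lam T U) = cong₂ lam (sub-cong h T) (sub-cong (exts-cong h) U)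
  sub-cong h (app t u) = cong₂ app (sub-cong h t) (sub-cong h u)

  exts-var : {σ : Sub S} {ρ : Ren} → (∀ x → σ x ≡ var (ρ x)) → ∀ x → exts σ x ≡ var (ext ρ x)
  exts-var h zero    = refl
  exts-var h (suc x) = cong (ren suc) (h x)

  sub-var : {σ : Sub S} {ρ : Ren} → (∀ x → σ x ≡ var (ρ x)) → (t : Tm S) → sub σ t ≡ ren ρ t
  sub-var h (var x)   = h x
  sub-var h (sort s)  = refl
  sub-var h (pi T U)  = cong₂ pi (sub-var h T) (sub-var (exts-var h) U)
  sub-var h (lam T U) = cong₂ lam (sub-var h T) (sub-var (exts-var h) U)
  sub-var h (app t u) = cong₂ app (sub-var h t) (sub-var h u)

  sub-id : {σ : Sub S} → (∀ x → σ x ≡ var x) → (t : Tm S) → sub σ t ≡ t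
  sub-id h t = trans (sub-var {ρ = λ x → x} h t) (ren-id t)

  sub-ren : (σ : Sub S) (ρ : Ren) (t : Tm S) → sub σ (ren ρ t) ≡ sub (σ ∘ ρ) t
  sub-ren σ ρ (var x)   = refl
  sub-ren σ ρ (sort s)  = refl
  sub-ren σ ρ (pi T U)  = cong₂ pi (sub-ren σ ρ T)
    (trans (sub-ren (exts σ) (ext ρ) U) (sub-cong (λ { zero → refl ; (suc x) → refl }) U))
  sub-ren σ ρ (lam T U) = cong₂ lam (sub-ren σ ρ T)
    (trans (sub-ren (exts σ) (ext ρ) U) (sub-cong (λ { zero → refl ; (suc x) → refl }) U))
  sub-ren σ ρ (app t u) = cong₂ app (sub-ren σ ρ t) (sub-ren σ ρ u)

  exts-ren : (ρ : Ren) (σ : Sub S) → ∀ x → ren (ext ρ) (exts σ x) ≡ exts (ren ρ ∘ σ) x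
  exts-ren ρ σ zero    = refl
  exts-ren ρ σ (suc x) = sym (ren-suc-comm ρ (σ x))

  ren-sub : (ρ : Ren) (σ : Sub S) (t : Tm S) → ren ρ (sub σ t) ≡ sub (ren ρ ∘ σ) t
  ren-sub ρ σ (var x)   = refl
  ren-sub ρ σ (sort s)  = refl
  ren-sub ρ σ (pi T U)  = cong₂ pi (ren-sub ρ σ T)
    (trans (ren-sub (ext ρ) (exts σ) U) (sub-cong (exts-ren ρ σ) U))
  ren-sub ρ σ (lam T U) = cong₂ lam (ren-sub ρ σ T)
    (trans (ren-sub (ext ρ) (exts σ) U) (sub-cong (exts-ren ρ σ) U))
  ren-sub ρ σ (app t u) = cong₂ app (ren-sub ρ σ t) (ren-sub ρ σ u)

  exts-sub : (τ σ : Sub S) → ∀ x → sub (exts τ) (exts σ x) ≡ exts (sub τ ∘ σ) x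
  exts-sub τ σ zero    = refl
  exts-sub τ σ (suc x) = trans (sub-ren (exts τ) suc (σ x)) (sym (ren-sub suc τ (σ x)))

  sub-sub : (τ σ : Sub S) (t : Tm S) → sub τ (sub σ t) ≡ sub (sub τ ∘ σ) t
  sub-sub τ σ (var x)   = refl
  sub-sub τ σ (sort s)  = refl
  sub-sub τ σ (pi T U)  = cong₂ pi (sub-sub τ σ T)
    (trans (sub-sub (exts τ) (exts σ) U) (sub-cong (exts-sub τ σ) U))
  sub-sub τ σ (lam T U) = cong₂ lam (sub-sub τ σ T)
    (trans (sub-sub (exts τ) (exts σ) U) (sub-cong (exts-sub τ σ) U))
  sub-sub τ σ (app t u) = cong₂ app (sub-sub τ σ t) (sub-sub τ σ u)

  sub-sub≡sub-sub : (a b c d : Sub S) (t : Tm S) → (∀ x → sub a (b x) ≡ sub c (d x))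
                  → sub a (sub b t) ≡ sub c (sub d t)
  sub-sub≡sub-sub a b c d t h = trans (sub-sub a b t) (trans (sub-cong h t) (sym (sub-sub c d t)))

  sub-sub≡sub : (a b c : Sub S) (t : Tm S) → (∀ x → sub a (b x) ≡ c x)
              → sub a (sub b t) ≡ sub c t
  sub-sub≡sub a b c t h = trans (sub-sub a b t) (sub-cong h t)

  sub-ren≡ren-sub : (σ τ : Sub S) (ρ' ρ : Ren) (t : Tm S) → (∀ x → σ (ρ' x) ≡ ren ρ (τ x))
                  → sub σ (ren ρ' t) ≡ ren ρ (sub τ t)
  sub-ren≡ren-sub σ τ ρ' ρ t h = trans (sub-ren σ ρ' t) (trans (sub-cong h t) (sym (ren-sub ρ τ t)))

  sub-wk : (u t : Tm S) → ren suc t [ u ] ≡ t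
  sub-wk u t = trans (sub-ren (u • var) suc t) (sub-id (λ _ → refl) t)

  sub-up-wk : (c t : Tm S) → sub (c • up) (ren suc t) ≡ ren suc t
  sub-up-wk c t = trans (sub-ren (c • up) suc t) (sub-var (λ _ → refl) t)

  ren-[] : (ρ : Ren) (t u : Tm S) → ren ρ (t [ u ]) ≡ ren (ext ρ) t [ ren ρ u ]
  ren-[] ρ t u = sym (sub-ren≡ren-sub (ren ρ u • var) (u • var) (ext ρ) ρ t
                   (λ { zero → refl ; (suc x) → refl }))

  sub-[] : (σ : Sub S) (t u : Tm S) → sub σ (t [ u ]) ≡ sub (exts σ) t [ sub σ u ]
  sub-[] σ t u = sub-sub≡sub-sub σ (u • var) (sub σ u • var) (exts σ) t
    (λ { zero → refl ; (suc x) → sym (sub-wk (sub σ u) (σ x)) })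

open PTSSubstitution public

module BetaStability {S : Set} where

  ren-⟶β : (ρ : Ren) {t t' : Tm S} → t ⟶β t' → ren ρ t ⟶β ren ρ t'
  ren-⟶β ρ (β {v} {t} {u}) = subst (ren ρ (app (lam v t) u) ⟶β_) (sym (ren-[] ρ t u)) β
  ren-⟶β ρ (piL r)  = piL (ren-⟶β ρ r)
  ren-⟶β ρ (piR r)  = piR (ren-⟶β (ext ρ) r)
  ren-⟶β ρ (lamL r) = lamL (ren-⟶β ρ r)
  ren-⟶β ρ (lamR r) = lamR (ren-⟶β (ext ρ) r)
  ren-⟶β ρ (appL r) = appL (ren-⟶β ρ r)
  ren-⟶β ρ (appR r) = appR (ren-⟶β ρ r)

  sub-⟶β : (σ : Sub S) {t t' : Tm S} → t ⟶β t' → sub σ t ⟶β sub σ t'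
  sub-⟶β σ (β {v} {t} {u}) = subst (sub σ (app (lam v t) u) ⟶β_) (sym (sub-[] σ t u)) β
  sub-⟶β σ (piL r)  = piL (sub-⟶β σ r)
  sub-⟶β σ (piR r)  = piR (sub-⟶β (exts σ) r)
  sub-⟶β σ (lamL r) = lamL (sub-⟶β σ r)
  sub-⟶β σ (lamR r) = lamR (sub-⟶β (exts σ) r)
  sub-⟶β σ (appL r) = appL (sub-⟶β σ r)
  sub-⟶β σ (appR r) = appR (sub-⟶β σ r)

  ren-↔β : (ρ : Ren) {t t' : Tm S} → t ↔β t' → ren ρ t ↔β ren ρ t'
  ren-↔β ρ = EC.gmap (ren ρ) (ren-⟶β ρ)

  sub-↔β : (σ : Sub S) {t t' : Tm S} → t ↔β t' → sub σ t ↔β sub σ t'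
  sub-↔β σ = EC.gmap (sub σ) (sub-⟶β σ)

  exts-↔β : {σ σ' : Sub S} → (∀ x → σ x ↔β σ' x) → ∀ x → exts σ x ↔β exts σ' x
  exts-↔β h zero    = ε
  exts-↔β h (suc x) = ren-↔β suc (h x)

  sub-pointwise-↔β : {σ σ' : Sub S} → (∀ x → σ x ↔β σ' x) → (t : Tm S) → sub σ t ↔β sub σ' t
  sub-pointwise-↔β h (var x)   = h x
  sub-pointwise-↔β h (sort s)  = ε
  sub-pointwise-↔β h (pi T U)  =
    ≈-cong₂ pi piL piR (sub-pointwise-↔β h T) (sub-pointwise-↔β (exts-↔β h) U)
  sub-pointwise-↔β h (lam T U) =
    ≈-cong₂ lam lamL lamR (sub-pointwise-↔β h T) (sub-pointwise-↔β (exts-↔β h) U)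
  sub-pointwise-↔β h (app t u) =
    ≈-cong₂ app appL appR (sub-pointwise-↔β h t) (sub-pointwise-↔β h u)

open BetaStability public

module PTSCRenaming {S : Set} where

  mutual
    renT-cong : {ρ ρ' : ℕ → ℕ} → (∀ x → ρ x ≡ ρ' x) → (M : PT S) → renT ρ M ≡ renT ρ' M
    renT-cong h (pi A B)     = cong₂ pi (renT-cong h A) (renT-cong (ext-cong h) B)
    renT-cong h (lam A B)    = cong₂ lam (renT-cong h A) (renT-cong (ext-cong h) B)
    renT-cong h (sort s)     = refl
    renT-cong h (varapp x l) = cong₂ varapp (h x) (renL-cong h l)
    renT-cong h (app M l)    = cong₂ app (renT-cong h M) (renL-cong h l)
    renT-cong h (esub N A M) =
      cong₃ esub (renT-cong h N) (renT-cong h A) (renT-cong (ext-cong h) M)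

    renL-cong : {ρ ρ' : ℕ → ℕ} → (∀ x → ρ x ≡ ρ' x) → (l : PL S) → renL ρ l ≡ renL ρ' l
    renL-cong h nil          = refl
    renL-cong h (cons M l)   = cong₂ cons (renT-cong h M) (renL-cong h l)
    renL-cong h (cat l l')   = cong₂ cat (renL-cong h l) (renL-cong h l')
    renL-cong h (esub N A l) =
      cong₃ esub (renT-cong h N) (renT-cong h A) (renL-cong (ext-cong h) l)

  mutual
    renT-∘ : (f g : ℕ → ℕ) (M : PT S) → renT f (renT g M) ≡ renT (f ∘ g) M
    renT-∘ f g (pi A B)     = cong₂ pi (renT-∘ f g A)
      (trans (renT-∘ (ext f) (ext g) B) (renT-cong (ext-∘ f g) B))
    renT-∘ f g (lam A B)    = cong₂ lam (renT-∘ f g A)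
      (trans (renT-∘ (ext f) (ext g) B) (renT-cong (ext-∘ f g) B))
    renT-∘ f g (sort s)     = refl
    renT-∘ f g (varapp x l) = cong (varapp _) (renL-∘ f g l)
    renT-∘ f g (app M l)    = cong₂ app (renT-∘ f g M) (renL-∘ f g l)
    renT-∘ f g (esub N A M) = cong₃ esub (renT-∘ f g N) (renT-∘ f g A)
      (trans (renT-∘ (ext f) (ext g) M) (renT-cong (ext-∘ f g) M))

    renL-∘ : (f g : ℕ → ℕ) (l : PL S) → renL f (renL g l) ≡ renL (f ∘ g) l
    renL-∘ f g nil          = refl
    renL-∘ f g (cons M l)   = cong₂ cons (renT-∘ f g M) (renL-∘ f g l)
    renL-∘ f g (cat l l')   = cong₂ cat (renL-∘ f g l) (renL-∘ f g l')
    renL-∘ f g (esub N A l) = cong₃ esub (renT-∘ f g N) (renT-∘ f g A)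
      (trans (renL-∘ (ext f) (ext g) l) (renL-cong (ext-∘ f g) l))

  mutual
    renT-id : (M : PT S) → renT (λ y → y) M ≡ M
    renT-id (pi A B)     = cong₂ pi (renT-id A) (trans (renT-cong ext-id B) (renT-id B))
    renT-id (lam A B)    = cong₂ lam (renT-id A) (trans (renT-cong ext-id B) (renT-id B))
    renT-id (sort s)     = refl
    renT-id (varapp x l) = cong (varapp x) (renL-id l)
    renT-id (app M l)    = cong₂ app (renT-id M) (renL-id l)
    renT-id (esub N A M) = cong₃ esub (renT-id N) (renT-id A)
      (trans (renT-cong ext-id M) (renT-id M))

    renL-id : (l : PL S) → renL (λ y → y) l ≡ l
    renL-id nil          = refl
    renL-id (cons M l)   = cong₂ cons (renT-id M) (renL-id l)
    renL-id (cat l l')   = cong₂ cat (renL-id l) (renL-id l')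
    renL-id (esub N A l) = cong₃ esub (renT-id N) (renT-id A)
      (trans (renL-cong ext-id l) (renL-id l))

open PTSCRenaming public

module TranslationB {S : Set} where

  mutual
    ℬ-ren : (ρ : Ren) (M : PT S) → ℬ (renT ρ M) ≡ ren ρ (ℬ M)
    ℬ-ren ρ (pi A B)     = cong₂ pi (ℬ-ren ρ A) (ℬ-ren (ext ρ) B)
    ℬ-ren ρ (lam A B)    = cong₂ lam (ℬ-ren ρ A) (ℬ-ren (ext ρ) B)
    ℬ-ren ρ (sort s)     = refl
    ℬ-ren ρ (varapp x l) = trans (cong (sub (var (ρ x) • var)) (ℬl-ren ρ l))
      (sub-ren≡ren-sub _ _ (ext ρ) ρ (ℬl l) (λ { zero → refl ; (suc n) → refl }))
    ℬ-ren ρ (app M l)    = trans (cong₂ (λ a b → sub (a • var) b) (ℬ-ren ρ M) (ℬl-ren ρ l))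
      (sub-ren≡ren-sub _ _ (ext ρ) ρ (ℬl l) (λ { zero → refl ; (suc n) → refl }))
    ℬ-ren ρ (esub N A M) = trans (cong₂ (λ a b → sub (a • var) b) (ℬ-ren ρ N) (ℬ-ren (ext ρ) M))
      (sub-ren≡ren-sub _ _ (ext ρ) ρ (ℬ M) (λ { zero → refl ; (suc n) → refl }))

    -- In ℬl l the hole is variable 0, so renamings act on it lifted.
    ℬl-ren : (ρ : Ren) (l : PL S) → ℬl (renL ρ l) ≡ ren (ext ρ) (ℬl l)
    ℬl-ren ρ nil          = refl
    ℬl-ren ρ (cons M l)   = trans (cong (sub _) (ℬl-ren ρ l))
      (sub-ren≡ren-sub _ _ (ext ρ) (ext ρ) (ℬl l)
        (λ { zero    → cong (app (var zero)) (trans (cong (ren suc) (ℬ-ren ρ M)) (ren-suc-comm ρ (ℬ M)))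
           ; (suc n) → refl }))
    ℬl-ren ρ (cat l l')   = trans (cong₂ (λ a b → sub (a • up) b) (ℬl-ren ρ l) (ℬl-ren ρ l'))
      (sub-ren≡ren-sub _ _ (ext ρ) (ext ρ) (ℬl l') (λ { zero → refl ; (suc n) → refl }))
    ℬl-ren ρ (esub P K l) =
      trans (cong₂ (λ a b → sub (var zero • (ren suc a • up)) b) (ℬ-ren ρ P) (ℬl-ren (ext ρ) l))
        (sub-ren≡ren-sub _ _ (ext (ext ρ)) (ext ρ) (ℬl l)
          (λ { zero → refl ; (suc zero) → ren-suc-comm ρ (ℬ P) ; (suc (suc n)) → refl }))

  ℬl-cons : (N : PT S) (l : PL S) (t : Tm S) → ℬl (cons N l) [ t ] ≡ ℬl l [ app t (ℬ N) ]
  ℬl-cons N l t = sub-sub≡sub _ _ _ (ℬl l)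
    (λ { zero → cong (app t) (sub-wk t (ℬ N)) ; (suc n) → refl })

  ℬl-cat : (l l' : PL S) (t : Tm S) → ℬl (cat l l') [ t ] ≡ ℬl l' [ ℬl l [ t ] ]
  ℬl-cat l l' t = sub-sub≡sub _ _ _ (ℬl l') (λ { zero → refl ; (suc n) → refl })

  ℬl-esub : (P K : PT S) (l : PL S) (t : Tm S)
          → ℬl (esub P K l) [ t ] ≡ ℬl l [ ren suc t ] [ ℬ P ]
  ℬl-esub P K l t = sub-sub≡sub-sub _ _ _ _ (ℬl l)
    (λ { zero → sym (sub-wk (ℬ P) t) ; (suc zero) → sub-wk t (ℬ P) ; (suc (suc n)) → refl })

  -- Pushing an explicit substitution under a binder (rules C1, C5)
  -- agrees with lifting the substitution in PTS.
  ℬ-under-binder : (P M : PT S) → ℬ (renT swap01 M) [ ℬ (renT suc P) ] ≡ sub (exts (ℬ P • var)) (ℬ M)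
  ℬ-under-binder P M = trans (cong₂ (λ a b → sub (b • var) a) (ℬ-ren swap01 M) (ℬ-ren suc P))
    (trans (sub-ren _ swap01 (ℬ M))
           (sub-cong (λ { zero → refl ; (suc zero) → refl ; (suc (suc n)) → refl }) (ℬ M)))

  -- Each rule of the PTSC is mapped to β-conversion: B1 to one β-step,
  -- every other root rule to a syntactic identity.
  mutual
    ℬ-step : {M N : PT S} → M ⟶ N → ℬ M ↔β ℬ N
    ℬ-step (B1 {A} {M} {N} {l}) = ≡⇒≈ (ℬl-cons N l _) ◅◅
      sub-pointwise-↔β (λ { zero → return β ; (suc n) → ε }) (ℬl l)
    ℬ-step B2                  = ε
    ℬ-step (B3 {x} {l} {l'})   = ≡⇒≈ (sym (ℬl-cat l l' (var x)))
    ℬ-step (B4 {M} {l} {l'})   = ≡⇒≈ (sym (ℬl-cat l l' (ℬ M)))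
    ℬ-step (C1 {P} {G} {A} {M}) = ≡⇒≈ (cong (lam _) (sym (ℬ-under-binder P M)))
    ℬ-step (C2 {P} {G} {l})    = ≡⇒≈ (sub-sub≡sub-sub _ _ _ _ (ℬl l)
      (λ { zero → refl ; (suc zero) → sym (sub-wk (ℬ P) (ℬ P)) ; (suc (suc n)) → refl }))
    ℬ-step (C3 {P} {G} {x} {l}) = ≡⇒≈ (sub-sub≡sub-sub _ _ _ _ (ℬl l)
      (λ { zero → refl ; (suc zero) → sym (sub-wk (var x) (ℬ P)) ; (suc (suc n)) → refl }))
    ℬ-step (C4 {P} {G} {M} {l}) = ≡⇒≈ (sub-sub≡sub-sub _ _ _ _ (ℬl l)
      (λ { zero → refl ; (suc zero) → sym (sub-wk (ℬ M [ ℬ P ]) (ℬ P)) ; (suc (suc n)) → refl }))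
    ℬ-step (C5 {P} {G} {A} {B}) = ≡⇒≈ (cong (pi _) (sym (ℬ-under-binder P B)))
    ℬ-step C6                  = ε
    ℬ-step (piL r)             = EC.gmap (λ z → pi z _) piL (ℬ-step r)
    ℬ-step (piR r)             = EC.gmap (pi _) piR (ℬ-step r)
    ℬ-step (lamL r)            = EC.gmap (λ z → lam z _) lamL (ℬ-step r)
    ℬ-step (lamR r)            = EC.gmap (lam _) lamR (ℬ-step r)
    ℬ-step (varappC r)         = sub-↔β _ (ℬl-step r)
    ℬ-step (appL {l = l} r)    = sub-pointwise-↔β (λ { zero → ℬ-step r ; (suc n) → ε }) (ℬl l)
    ℬ-step (appR r)            = sub-↔β _ (ℬl-step r)
    ℬ-step (esub1 {M = M} r)   = sub-pointwise-↔β (λ { zero → ℬ-step r ; (suc n) → ε }) (ℬ M)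
    ℬ-step (esub2 r)           = ε
    ℬ-step (esub3 r)           = sub-↔β _ (ℬ-step r)

    ℬl-step : {l l' : PL S} → l ⟶ₗ l' → ℬl l ↔β ℬl l'
    ℬl-step (A1 {M} {l'} {l})  = ≡⇒≈ (sym (sub-sub≡sub _ _ _ (ℬl l) (λ { zero → refl ; (suc n) → refl })))
    ℬl-step (A2 {l})           = ≡⇒≈ (sub-id (λ { zero → refl ; (suc n) → refl }) (ℬl l))
    ℬl-step (A3 {l} {l'} {l''}) = ≡⇒≈ (sym (sub-sub≡sub _ _ _ (ℬl l'') (λ { zero → refl ; (suc n) → refl })))
    ℬl-step A4                 = ε
    ℬl-step D1                 = ε
    ℬl-step (D2 {P} {G} {M} {l}) = ≡⇒≈ (sub-sub≡sub-sub _ _ _ _ (ℬl l)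
      (λ { zero → cong (app (var zero))
                    (sub-ren≡ren-sub _ _ suc suc (ℬ M) (λ { zero → refl ; (suc n) → refl }))
         ; (suc zero) → sym (sub-up-wk _ (ℬ P))
         ; (suc (suc n)) → refl }))
    ℬl-step (D3 {P} {G} {l} {l'}) = ≡⇒≈ (sub-sub≡sub-sub _ _ _ _ (ℬl l')
      (λ { zero → refl ; (suc zero) → sym (sub-up-wk _ (ℬ P)) ; (suc (suc n)) → refl }))
    ℬl-step (consL {l = l} r)  = sub-pointwise-↔β
      (λ { zero → EC.gmap (app (var zero)) appR (ren-↔β suc (ℬ-step r)) ; (suc n) → ε }) (ℬl l)
    ℬl-step (consR r)          = sub-↔β _ (ℬl-step r)
    ℬl-step (catL {k = k} r)   = sub-pointwise-↔β (λ { zero → ℬl-step r ; (suc n) → ε }) (ℬl k)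
    ℬl-step (catR r)           = sub-↔β _ (ℬl-step r)
    ℬl-step (esub1 {l = l} r)  = sub-pointwise-↔β
      (λ { zero → ε ; (suc zero) → ren-↔β suc (ℬ-step r) ; (suc (suc n)) → ε }) (ℬl l)
    ℬl-step (esub2 r)          = ε
    ℬl-step (esub3 r)          = sub-↔β _ (ℬl-step r)

  ℬ-sound : {M N : PT S} → M ↔ N → ℬ M ↔β ℬ N
  ℬ-sound = gfold (EC.isEquivalence _) ℬ ℬ-step

  mutual
    ℬ∘𝒜 : (t : Tm S) → ℬ (𝒜 t) ≡ t
    ℬ∘𝒜 (var x)   = refl
    ℬ∘𝒜 (sort s)  = refl
    ℬ∘𝒜 (pi T U)  = cong₂ pi (ℬ∘𝒜 T) (ℬ∘𝒜 U)
    ℬ∘𝒜 (lam T U) = cong₂ lam (ℬ∘𝒜 T) (ℬ∘𝒜 U)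
    ℬ∘𝒜 (app t u) = trans (ℬ∘𝒜l (cons (𝒜 u) nil) t)
      (trans (ℬl-cons (𝒜 u) nil t) (cong (app t) (ℬ∘𝒜 u)))

    ℬ∘𝒜l : (l : PL S) (t : Tm S) → ℬ (𝒜l l t) ≡ ℬl l [ t ]
    ℬ∘𝒜l l (var x)   = refl
    ℬ∘𝒜l l (sort s)  = refl
    ℬ∘𝒜l l (pi T U)  = cong (λ z → ℬl l [ z ]) (cong₂ pi (ℬ∘𝒜 T) (ℬ∘𝒜 U))
    ℬ∘𝒜l l (lam T U) = cong (λ z → ℬl l [ z ]) (cong₂ lam (ℬ∘𝒜 T) (ℬ∘𝒜 U))
    ℬ∘𝒜l l (app t u) = trans (ℬ∘𝒜l (cons (𝒜 u) l) t)
      (trans (ℬl-cons (𝒜 u) l t) (cong (λ z → ℬl l [ app t z ]) (ℬ∘𝒜 u)))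

open TranslationB public

module TranslationA {S : Set} where

  _↔ₗ_ : PL S → PL S → Set
  _↔ₗ_ = EqClosure _⟶ₗ_

  step : {M N : PT S} → M ⟶ N → M ↔ N
  step = return

  pi-↔ : {A A' B B' : PT S} → A ↔ A' → B ↔ B' → pi A B ↔ pi A' B'
  pi-↔ = ≈-cong₂ pi piL piR

  lam-↔ : {A A' B B' : PT S} → A ↔ A' → B ↔ B' → lam A B ↔ lam A' B'
  lam-↔ = ≈-cong₂ lam lamL lamR

  appˡ-↔ : {M M' : PT S} {l : PL S} → M ↔ M' → app M l ↔ app M' l
  appˡ-↔ = EC.gmap (λ z → app z _) appL

  appʳ-↔ : {M : PT S} {l l' : PL S} → l ↔ₗ l' → app M l ↔ app M l'
  appʳ-↔ = EC.gmap (app _) appR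

  consˡ-↔ : {M M' : PT S} {l : PL S} → M ↔ M' → cons M l ↔ₗ cons M' l
  consˡ-↔ = EC.gmap (λ z → cons z _) consL

  esubˡ-↔ : {N N' A M : PT S} → N ↔ N' → esub N A M ↔ esub N' A M
  esubˡ-↔ = EC.gmap (λ z → esub z _ _) esub1

  esubʳ-↔ : {N A M M' : PT S} → M ↔ M' → esub N A M ↔ esub N A M'
  esubʳ-↔ = EC.gmap (esub _ _) esub3

  app-cons-nil : (M a : PT S) (l : PL S) → app (app M (cons a nil)) l ↔ app M (cons a l)
  app-cons-nil M a l = step B4 ◅◅ step (appR A1) ◅◅ step (appR (consR A2))

  varapp-nil : (x : ℕ) (l : PL S) → app (varapp x nil) l ↔ varapp x l
  varapp-nil x l = step B3 ◅◅ step (varappC A2)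

  𝒜l-app : (l : PL S) (t : Tm S) → 𝒜l l t ↔ app (𝒜 t) l
  𝒜l-app l (var x)   = ≈-sym (varapp-nil x l)
  𝒜l-app l (sort s)  = ε
  𝒜l-app l (pi T U)  = ε
  𝒜l-app l (lam T U) = ε
  𝒜l-app l (app t u) = 𝒜l-app (cons (𝒜 u) l) t ◅◅
    ≈-sym (appˡ-↔ (𝒜l-app (cons (𝒜 u) nil) t) ◅◅ app-cons-nil (𝒜 t) (𝒜 u) l)

  mutual
    𝒜-ren : (ρ : Ren) (t : Tm S) → 𝒜 (ren ρ t) ≡ renT ρ (𝒜 t)
    𝒜-ren ρ (var x)   = refl
    𝒜-ren ρ (sort s)  = refl
    𝒜-ren ρ (pi T U)  = cong₂ pi (𝒜-ren ρ T) (𝒜-ren (ext ρ) U)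
    𝒜-ren ρ (lam T U) = cong₂ lam (𝒜-ren ρ T) (𝒜-ren (ext ρ) U)
    𝒜-ren ρ (app t u) = trans (cong (λ z → 𝒜l (cons z nil) (ren ρ t)) (𝒜-ren ρ u))
                              (𝒜l-ren ρ (cons (𝒜 u) nil) t)

    𝒜l-ren : (ρ : Ren) (l : PL S) (t : Tm S) → 𝒜l (renL ρ l) (ren ρ t) ≡ renT ρ (𝒜l l t)
    𝒜l-ren ρ l (var x)   = refl
    𝒜l-ren ρ l (sort s)  = refl
    𝒜l-ren ρ l (pi T U)  = cong (λ z → app z (renL ρ l)) (𝒜-ren ρ (pi T U))
    𝒜l-ren ρ l (lam T U) = cong (λ z → app z (renL ρ l)) (𝒜-ren ρ (lam T U))
    𝒜l-ren ρ l (app t u) = trans (cong (λ z → 𝒜l (cons z (renL ρ l)) (ren ρ t)) (𝒜-ren ρ u))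
                                 (𝒜l-ren ρ (cons (𝒜 u) l) t)

  -- Under k binders, substituting v for variable k is the substitution
  -- liftⁿ k (v • var), the substituted term is weakened k times, and on
  -- the PTSC side the explicit substitution binds variable k, which the
  -- renaming toFront k moves to position 0 (each binder crossed by rule
  -- C1/C5 contributes one swap01).
  liftⁿ : ℕ → Sub S → Sub S
  liftⁿ zero    σ = σ
  liftⁿ (suc k) σ = exts (liftⁿ k σ)

  wkⁿ : ℕ → Tm S → Tm S
  wkⁿ zero    v = v
  wkⁿ (suc k) v = ren suc (wkⁿ k v)

  toFront : ℕ → Ren
  toFront zero    x = x
  toFront (suc k) x = swap01 (ext (toFront k) x)

  toFront-var : (v : Tm S) (k x : ℕ)
              → (toFront k x ≡ zero × liftⁿ k (v • var) x ≡ wkⁿ k v)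
              ⊎ ∃ λ y → toFront k x ≡ suc y × liftⁿ k (v • var) x ≡ var y
  toFront-var v zero    zero    = inj₁ (refl , refl)
  toFront-var v zero    (suc x) = inj₂ (x , refl , refl)
  toFront-var v (suc k) zero    = inj₂ (zero , refl , refl)
  toFront-var v (suc k) (suc x) with toFront-var v k x
  ... | inj₁ (front , subst≡) rewrite front = inj₁ (refl , cong (ren suc) subst≡)
  ... | inj₂ (y , front , subst≡) rewrite front = inj₂ (suc y , refl , cong (ren suc) subst≡)

  𝒜-subst-var : (x k : ℕ) (v : Tm S) (K : PT S) (l : PL S)
              → esub (𝒜 (wkⁿ k v)) K (renT (toFront k) (varapp x l))
                ↔ app (𝒜 (liftⁿ k (v • var) x)) (esub (𝒜 (wkⁿ k v)) K (renL (toFront k) l))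
  𝒜-subst-var x k v K l with toFront-var v k x
  ... | inj₁ (front , subst≡) rewrite front | subst≡ = step C2
  ... | inj₂ (y , front , subst≡) rewrite front | subst≡ = step C3 ◅◅ ≈-sym (varapp-nil y _)

  mutual
    𝒜-substⁿ : (t : Tm S) (k : ℕ) (v : Tm S) (K : PT S)
             → esub (𝒜 (wkⁿ k v)) K (renT (toFront k) (𝒜 t)) ↔ 𝒜 (sub (liftⁿ k (v • var)) t)
    𝒜-substⁿ (var x) k v K = 𝒜l-substⁿ (var x) k v K nil ◅◅ step (appR D1) ◅◅ step B2
    𝒜-substⁿ (app t u) k v K = 𝒜l-substⁿ t k v K (cons (𝒜 u) nil) ◅◅ step (appR D2) ◅◅
      appʳ-↔ (consˡ-↔ (𝒜-substⁿ u k v K)) ◅◅ step (appR (consR D1)) ◅◅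
      ≈-sym (𝒜l-app _ (sub (liftⁿ k (v • var)) t))
    𝒜-substⁿ (sort s) k v K = step C6
    𝒜-substⁿ (pi T U) k v K = step C5 ◅◅
      ≡⇒≈ (cong₂ (λ a b → pi (esub (𝒜 (wkⁿ k v)) K (renT (toFront k) (𝒜 T))) (esub a (renT suc K) b))
                 (sym (𝒜-ren suc (wkⁿ k v))) (renT-∘ swap01 (ext (toFront k)) (𝒜 U))) ◅◅
      pi-↔ (𝒜-substⁿ T k v K) (𝒜-substⁿ U (suc k) v (renT suc K))
    𝒜-substⁿ (lam T U) k v K = step C1 ◅◅
      ≡⇒≈ (cong₂ (λ a b → lam (esub (𝒜 (wkⁿ k v)) K (renT (toFront k) (𝒜 T))) (esub a (renT suc K) b))
                 (sym (𝒜-ren suc (wkⁿ k v))) (renT-∘ swap01 (ext (toFront k)) (𝒜 U))) ◅◅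
      lam-↔ (𝒜-substⁿ T k v K) (𝒜-substⁿ U (suc k) v (renT suc K))

    𝒜l-substⁿ : (t : Tm S) (k : ℕ) (v : Tm S) (K : PT S) (l : PL S)
              → esub (𝒜 (wkⁿ k v)) K (renT (toFront k) (𝒜l l t))
                ↔ app (𝒜 (sub (liftⁿ k (v • var)) t)) (esub (𝒜 (wkⁿ k v)) K (renL (toFront k) l))
    𝒜l-substⁿ (var x) k v K l   = 𝒜-subst-var x k v K l
    𝒜l-substⁿ (sort s) k v K l  = step C4 ◅◅ appˡ-↔ (𝒜-substⁿ (sort s) k v K)
    𝒜l-substⁿ (pi T U) k v K l  = step C4 ◅◅ appˡ-↔ (𝒜-substⁿ (pi T U) k v K)
    𝒜l-substⁿ (lam T U) k v K l = step C4 ◅◅ appˡ-↔ (𝒜-substⁿ (lam T U) k v K)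
    𝒜l-substⁿ (app t u) k v K l = 𝒜l-substⁿ t k v K (cons (𝒜 u) l) ◅◅ step (appR D2) ◅◅
      appʳ-↔ (consˡ-↔ (𝒜-substⁿ u k v K)) ◅◅
      ≈-sym (appˡ-↔ (𝒜l-app _ (sub (liftⁿ k (v • var)) t)) ◅◅ app-cons-nil _ _ _)

  𝒜-subst : (t v : Tm S) (K : PT S) → esub (𝒜 v) K (𝒜 t) ↔ 𝒜 (t [ v ])
  𝒜-subst t v K = ≡⇒≈ (cong (esub _ _) (sym (renT-id (𝒜 t)))) ◅◅ 𝒜-substⁿ t zero v K

  𝒜-subst-wk : (t v : Tm S) (K : PT S) → esub (𝒜 v) K (renT suc (𝒜 t)) ↔ 𝒜 t
  𝒜-subst-wk t v K = ≡⇒≈ (cong (esub _ K) (sym (𝒜-ren suc t))) ◅◅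
    𝒜-subst (ren suc t) v K ◅◅ ≡⇒≈ (cong 𝒜 (sub-wk v t))

  𝒜-step : {t u : Tm S} → t ⟶β u → 𝒜 t ↔ 𝒜 u
  𝒜-step (β {v} {t} {u}) = step B1 ◅◅ step B2 ◅◅ 𝒜-subst t u (𝒜 v)
  𝒜-step (piL r)  = pi-↔ (𝒜-step r) ε
  𝒜-step (piR r)  = pi-↔ ε (𝒜-step r)
  𝒜-step (lamL r) = lam-↔ (𝒜-step r) ε
  𝒜-step (lamR r) = lam-↔ ε (𝒜-step r)
  𝒜-step (appL {t} {t'} r) = 𝒜l-app _ t ◅◅ appˡ-↔ (𝒜-step r) ◅◅ ≈-sym (𝒜l-app _ t')
  𝒜-step (appR {t} r) = 𝒜l-app _ t ◅◅ appʳ-↔ (consˡ-↔ (𝒜-step r)) ◅◅ ≈-sym (𝒜l-app _ t)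

  𝒜-sound : {t u : Tm S} → t ↔β u → 𝒜 t ↔ 𝒜 u
  𝒜-sound = gfold (EC.isEquivalence _) 𝒜 𝒜-step

  mutual
    𝒜∘ℬ : (M : PT S) → M ↔ 𝒜 (ℬ M)
    𝒜∘ℬ (pi A B)     = pi-↔ (𝒜∘ℬ A) (𝒜∘ℬ B)
    𝒜∘ℬ (lam A B)    = lam-↔ (𝒜∘ℬ A) (𝒜∘ℬ B)
    𝒜∘ℬ (sort s)     = ε
    𝒜∘ℬ (varapp x l) = ≈-sym (𝒜∘ℬl l (var x) ◅◅ varapp-nil x l)
    𝒜∘ℬ (app M l)    = appˡ-↔ (𝒜∘ℬ M) ◅◅ ≈-sym (𝒜∘ℬl l (ℬ M))
    𝒜∘ℬ (esub P K M) = esubˡ-↔ (𝒜∘ℬ P) ◅◅ esubʳ-↔ (𝒜∘ℬ M) ◅◅ 𝒜-subst (ℬ M) (ℬ P) K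

    𝒜∘ℬl : (l : PL S) (t : Tm S) → 𝒜 (ℬl l [ t ]) ↔ app (𝒜 t) l
    𝒜∘ℬl nil t          = ≈-sym (step B2)
    𝒜∘ℬl (cons M l) t   = ≡⇒≈ (cong 𝒜 (ℬl-cons M l t)) ◅◅ 𝒜∘ℬl l (app t (ℬ M)) ◅◅
      appˡ-↔ (𝒜l-app _ t) ◅◅ app-cons-nil _ _ _ ◅◅ appʳ-↔ (consˡ-↔ (≈-sym (𝒜∘ℬ M)))
    𝒜∘ℬl (cat l l') t   = ≡⇒≈ (cong 𝒜 (ℬl-cat l l' t)) ◅◅ 𝒜∘ℬl l' (ℬl l [ t ]) ◅◅
      appˡ-↔ (𝒜∘ℬl l t) ◅◅ step B4
    𝒜∘ℬl (esub P K l) t = ≡⇒≈ (cong 𝒜 (ℬl-esub P K l t)) ◅◅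
      ≈-sym (𝒜-subst (ℬl l [ ren suc t ]) (ℬ P) K) ◅◅
      esubʳ-↔ (𝒜∘ℬl l (ren suc t)) ◅◅
      esubˡ-↔ (≈-sym (𝒜∘ℬ P)) ◅◅
      ≡⇒≈ (cong (λ z → esub P K (app z l)) (𝒜-ren suc t)) ◅◅
      step C4 ◅◅
      appˡ-↔ (esubˡ-↔ (𝒜∘ℬ P) ◅◅ 𝒜-subst-wk t (ℬ P) K)

open TranslationA public

corollary4p2 : {S : Set}
    → ((t u : Tm S) → (t ↔β u) ⇔ (𝒜 t ↔ 𝒜 u))
    × ((M N : PT S) → (M ↔ N) ⇔ (ℬ M ↔β ℬ N))
corollary4p2 = 𝒜-characterisation , ℬ-characterisation
  where
    𝒜-characterisation : ∀ {S} (t u : Tm S) → (t ↔β u) ⇔ (𝒜 t ↔ 𝒜 u)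
    𝒜-characterisation t u = mk⇔ 𝒜-sound
      (λ 𝒜t↔𝒜u → ≡⇒≈ (sym (ℬ∘𝒜 t)) ◅◅ ℬ-sound 𝒜t↔𝒜u ◅◅ ≡⇒≈ (ℬ∘𝒜 u))

    ℬ-characterisation : ∀ {S} (M N : PT S) → (M ↔ N) ⇔ (ℬ M ↔β ℬ N)
    ℬ-characterisation M N = mk⇔ ℬ-sound
      (λ ℬM↔βℬN → 𝒜∘ℬ M ◅◅ 𝒜-sound ℬM↔βℬN ◅◅ ≈-sym (𝒜∘ℬ N))
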